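{- Let $\mathcal{G}_W=(L_1,L_2,l_0,X,\mathit{Act},\mathit{Obs},\mathit{flow},E,\mathit{lbl})$ be an initialized stopwatch game, let $\overline{\mathcal{G}_W}$ be the game with reset-memory described in the context, and let $\beta_1=\{((l,v),((l,f),v)) : (l,v)\in Q(\mathcal{G}_W),\ f\in F\}$. Then the inverse relation $\beta_1^{ -1}=\{(((l,f),v),(l,v)) : ((l,v),((l,f),v))\in\beta_1\}$ witnesses $T(\overline{\mathcal{G}_W})\preceq_s T(\mathcal{G}_W)$.
   Context: A simple compact constraint over a finite set $X$ of real variables is a conjunction containing, for each $x\in X$, exactly one conjunct $x\in I$ with $I$ a compact interval with rational endpoints; $\varphi(x)$ denotes that interval. An initialized singular game is a tuple $\mathcal{G}=(L_1,L_2,l_0,X,\mathit{Act},\mathit{Obs},\mathit{flow},E,\mathit{lbl})$ where $L_1,L_2$ are disjoint finite sets of locations (owned by Player 1 and Player 2 respectively), $l_0\in L_1$, $X$ is a finite set of real variables, $\mathit{Act}$ a finite set of actions, $\mathit{Obs}$ a finite set of observations, $\mathit{lbl}:L_1\cup L_2\to\mathit{Obs}$, $\mathit{flow}:(L_1\cup L_2)\times X\to\mathbb{Q}$, and $E$ is a set of edges $e=(l,a,\varphi_e,\mathit{rst}_e,l')$ with $l,l'\in L_1\cup L_2$, $a\in\mathit{Act}$, $\varphi_e$ a simple compact constraint over $X$, and $\mathit{rst}_e:X\to\mathbb{Q}\cup\{\bot\}$, such that $\mathit{flow}(l,x)\neq\mathit{flow}(l',x)$ implies $\mathit{rst}_e(x)\neq\bot$.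 An initialized stopwatch game is an initialized singular game with $\mathit{flow}(l,x)\in\{0,1\}$ for all $l,x$. Semantics: the transition system $T(\mathcal{G})$ has configurations $Q(\mathcal{G})=(L_1\cup L_2)\times\mathbb{R}^X$, initial configuration $(l_0,\vec 0)$, moves $\mathit{Act}\times\mathbb{R}_{\ge 0}$, and a transition $(l,v)\xrightarrow{(a,t)}(l',v')$ whenever there is an edge $e=(l,a,\varphi_e,\mathit{rst}_e,l')$ such that for every $x\in X$: $v(x)+t\cdot\mathit{flow}(l,x)\in\varphi_e(x)$, and $v'(x)=\mathit{rst}_e(x)$ if $\mathit{rst}_e(x)\neq\bot$, $v'(x)=v(x)+t\cdot\mathit{flow}(l,x)$ otherwise. $Q_i(\mathcal{G})$ is the set of configurations whose location lies in $L_i$; $\mathit{lbl}$ is extended to configurations via their location. Alternating simulation: for two such games $\mathcal{G}^1,\mathcal{G}^2$ with the same observation set, a relation $R\subseteq (Q_1(\mathcal{G}^1)\times Q_1(\mathcal{G}^2))\cup(Q_2(\mathcal{G}^1)\times Q_2(\mathcal{G}^2))$ is a simulation if for every $(p,q)\in R$: (1) $\mathit{lbl}^1(p)=\mathit{lbl}^2(q)$; (2) if $p\in Q_1(\mathcal{G}^1)$, then for every move $m$ and every transition $p\xrightarrow{m}p'$ in $T(\mathcal{G}^1)$ there exist a move $m'$ and a transition $q\xrightarrow{m'}q'$ in $T(\mathcal{G}^2)$ with $(p',q')\in R$; (3) if $p\in Q_2(\mathcal{G}^1)$, then for every move $m'$ and every transition $q\xrightarrow{m'}q'$ in $T(\mathcal{G}^2)$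 there exist a move $m$ and a transition $p\xrightarrow{m}p'$ in $T(\mathcal{G}^1)$ with $(p',q')\in R$. $R$ witnesses $T(\mathcal{G}^1)\preceq_s T(\mathcal{G}^2)$ if $R$ is a simulation containing the pair of initial configurations. Construction of $\overline{\mathcal{G}_W}$: let $K$ be the set of constants used in $\mathcal{G}_W$ together with $0$, $K_\bot=K\cup\{\bot\}$, and $F$ the set of functions $f:X\to K_\bot$. Then $\overline{\mathcal{G}_W}=(\overline{L_1},\overline{L_2},\overline{l_0},X,\mathit{Act},\mathit{Obs},\overline{\mathit{flow}},\overline{E},\overline{\mathit{lbl}})$ with $\overline{L_i}=L_i\times F$, $\overline{l_0}=(l_0,f_0)$ where $f_0\equiv 0$, $\overline{\mathit{flow}}((l,f),x)=\mathit{flow}(l,x)$, $\overline{\mathit{lbl}}(l,f)=\mathit{lbl}(l)$, and $\overline{E}$ consists of all edges $((l_1,f_1),a,\varphi,\mathit{rst},(l_2,f_2))$ such that $(l_1,a,\varphi,\mathit{rst},l_2)\in E$, $f_1\in F$, and for every $x\in X$: $f_2(x)=\bot$ if $\mathit{flow}(l_2,x)=1$; $f_2(x)=\mathit{rst}(x)$ if $\mathit{flow}(l_2,x)=0$ and $\mathit{rst}(x)\neq\bot$; $f_2(x)=f_1(x)$ if $\mathit{flow}(l_2,x)=0$ and $\mathit{rst}(x)=\bot$. -}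

module Defs where

open import Level using (Level; suc; _⊔_)
open import Data.Nat using (ℕ)
open import Data.Fin using (Fin)
open import Data.Maybe using (Maybe; just; nothing)
open import Data.Product using (Σ; ∃; _×_; _,_; proj₁; proj₂)
open import Data.Sum using (_⊎_; inj₁; inj₂)
open import Data.List using (List)
open import Data.List.Membership.Propositional using (_∈_)
open import Data.Rational using (ℚ; 0ℚ; 1ℚ) renaming (_≤_ to _≤ℚ_)
open import Relation.Binary.PropositionalEquality using (_≡_)
open import Relation.Nullary using (¬_)
open import Data.Unit using (⊤)

-- The paper uses ℝ; the stdlib has no reals, so we quantify over an
-- arbitrary structure with a carrier, + , * , ≤ and an embedding of ℚ
-- (ℝ is one instance).

record RealDomain : Set₁ where
  field
    Carrier : Set
    _+_ _*_ : Carrier → Carrier → Carrier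
    _≤_     : Carrier → Carrier → Set
    ι       : ℚ → Carrier
  infixl 6 _+_
  infixl 7 _*_
  infix 4 _≤_

record Interval : Set where
  constructor [_,_]⟨_⟩
  field
    lo hi : ℚ
    lo≤hi : lo ≤ℚ hi

-- edge e = (l, a, φ_e, rst_e, l') over variables Fin n
-- (φ_e : simple compact constraint = one interval per variable,
--  rst_e x = nothing stands for ⊥)
record Edge (Loc Act : Set) (n : ℕ) : Set where
  constructor edge
  field
    src   : Loc
    act   : Act
    guard : Fin n → Interval
    rst   : Fin n → Maybe ℚ
    tgt   : Loc

record Game : Set₁ where
  field
    L₁ L₂ : Set
    l₀    : L₁
    nX    : ℕ
    Act   : Set
    Obs   : Set
    flow  : L₁ ⊎ L₂ → Fin nX → ℚ
    IsEdge : Edge (L₁ ⊎ L₂) Act nX → Set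
    lbl   : L₁ ⊎ L₂ → Obs
  Loc : Set
  Loc = L₁ ⊎ L₂

record StopwatchGame : Set where
  field
    n₁ n₂ nX nAct nObs : ℕ
    l₀    : Fin n₁
    flow  : Fin n₁ ⊎ Fin n₂ → Fin nX → ℚ
    edges : List (Edge (Fin n₁ ⊎ Fin n₂) (Fin nAct) nX)
    lbl   : Fin n₁ ⊎ Fin n₂ → Fin nObs
    stopwatch : ∀ l x → flow l x ≡ 0ℚ ⊎ flow l x ≡ 1ℚ
    initialized : ∀ e → e ∈ edges → ∀ x →
      ¬ (flow (Edge.src e) x ≡ flow (Edge.tgt e) x) → ¬ (Edge.rst e x ≡ nothing)
  Loc : Set
  Loc = Fin n₁ ⊎ Fin n₂

toGame : StopwatchGame → Game
toGame G = record
  { L₁ = Fin n₁ ; L₂ = Fin n₂ ; l₀ = l₀ ; nX = nX ; Act = Fin nAct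
  ; Obs = Fin nObs ; flow = flow ; IsEdge = λ e → e ∈ edges ; lbl = lbl }
  where open StopwatchGame G

module Semantics (ℝ : RealDomain) where
  open RealDomain ℝ

  Time : Set
  Time = Σ Carrier (λ t → ι 0ℚ ≤ t)

  Config : Game → Set
  Config G = Game.Loc G × (Fin (Game.nX G) → Carrier)

  Move : Game → Set
  Move G = Game.Act G × Time

  data Player : Set where
    P₁ P₂ : Player

  owner : {A B : Set} → A ⊎ B → Player
  owner (inj₁ _) = P₁
  owner (inj₂ _) = P₂

  ownerQ : (G : Game) → Config G → Player
  ownerQ G (l , _) = owner l

  lblQ : (G : Game) → Config G → Game.Obs G
  lblQ G (l , _) = Game.lbl G l

  initial : (G : Game) → Config G
  initial G = inj₁ (Game.l₀ G) , λ _ → ι 0ℚ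

  _∈I_ : Carrier → Interval → Set
  c ∈I I = ι (Interval.lo I) ≤ c × c ≤ ι (Interval.hi I)

  update : Maybe ℚ → Carrier → Carrier
  update (just c) _ = ι c
  update nothing  w = w

  Step : (G : Game) → Config G → Move G → Config G → Set
  Step G (l , v) (a , t) (l' , v') =
    ∃ λ (e : Edge (Game.Loc G) (Game.Act G) (Game.nX G)) →
      Game.IsEdge G e × Edge.src e ≡ l × Edge.act e ≡ a × Edge.tgt e ≡ l' ×
      (∀ x → (v x + proj₁ t * ι (Game.flow G l x)) ∈I Edge.guard e x) ×
      (∀ x → v' x ≡ update (Edge.rst e x) (v x + proj₁ t * ι (Game.flow G l x)))

  IsSimulation : (G¹ G² : Game) → Game.Obs G¹ ≡ Game.Obs G² →
                 (Config G¹ → Config G² → Set) → Set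
  IsSimulation G¹ G² obs R = ∀ p q → R p q →
      ownerQ G¹ p ≡ ownerQ G² q
    × Relation.Binary.PropositionalEquality.subst (λ O → O) obs (lblQ G¹ p) ≡ lblQ G² q
    × (ownerQ G¹ p ≡ P₁ → ∀ m p' → Step G¹ p m p' →
         ∃ λ m' → ∃ λ q' → Step G² q m' q' × R p' q')
    × (ownerQ G¹ p ≡ P₂ → ∀ m' q' → Step G² q m' q' →
         ∃ λ m → ∃ λ p' → Step G¹ p m p' × R p' q')

  Witnesses : (G¹ G² : Game) → Game.Obs G¹ ≡ Game.Obs G² →
              (Config G¹ → Config G² → Set) → Set
  Witnesses G¹ G² obs R = IsSimulation G¹ G² obs R × R (initial G¹) (initial G²)

module ResetMemory (G : StopwatchGame) where
  open StopwatchGame G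

  InK : ℚ → Set
  InK c = c ≡ 0ℚ
        ⊎ (∃ λ l → ∃ λ x → flow l x ≡ c)
        ⊎ (∃ λ e → e ∈ edges × ∃ λ x →
              Interval.lo (Edge.guard e x) ≡ c
            ⊎ Interval.hi (Edge.guard e x) ≡ c
            ⊎ Edge.rst e x ≡ just c)

  InK⊥ : Maybe ℚ → Set
  InK⊥ nothing  = ⊤
  InK⊥ (just c) = InK c

  F : Set
  F = Σ (Fin nX → Maybe ℚ) (λ f → ∀ x → InK⊥ (f x))

  f₀ : F
  f₀ = (λ _ → just 0ℚ) , (λ _ → inj₁ Relation.Binary.PropositionalEquality.refl)

  L̄ : Set
  L̄ = (Fin n₁ × F) ⊎ (Fin n₂ × F)

  base : L̄ → Loc
  base (inj₁ (l , _)) = inj₁ l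
  base (inj₂ (l , _)) = inj₂ l

  mem : L̄ → F
  mem (inj₁ (_ , f)) = f
  mem (inj₂ (_ , f)) = f

  attach : Loc → F → L̄
  attach (inj₁ l) f = inj₁ (l , f)
  attach (inj₂ l) f = inj₂ (l , f)

  MemUpdate : ℚ → Maybe ℚ → Maybe ℚ → Maybe ℚ → Set
  MemUpdate fl r m₁ m₂ =
      (fl ≡ 1ℚ → m₂ ≡ nothing)
    × (fl ≡ 0ℚ → ∀ c → r ≡ just c → m₂ ≡ just c)
    × (fl ≡ 0ℚ → r ≡ nothing → m₂ ≡ m₁)

  IsEdgeBar : Edge L̄ (Fin nAct) nX → Set
  IsEdgeBar (edge l̄₁ a φ r l̄₂) =
      edge (base l̄₁) a φ r (base l̄₂) ∈ edges
    × (∀ x → MemUpdate (flow (base l̄₂) x) (r x)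
                       (proj₁ (mem l̄₁) x) (proj₁ (mem l̄₂) x))

  Gbar : Game
  Gbar = record
    { L₁ = Fin n₁ × F ; L₂ = Fin n₂ × F ; l₀ = l₀ , f₀ ; nX = nX
    ; Act = Fin nAct ; Obs = Fin nObs
    ; flow = λ l̄ x → flow (base l̄) x
    ; IsEdge = IsEdgeBar
    ; lbl = λ l̄ → lbl (base l̄) }

  module _ (ℝ : RealDomain) where
    open Semantics ℝ

    data β₁ : Config (toGame G) → Config Gbar → Set where
      mk : ∀ l v (f : F) → β₁ (l , v) (attach l f , v)

    β₁⁻¹ : Config Gbar → Config (toGame G) → Set
    β₁⁻¹ p q = β₁ q p

-- A Player-1 move of the memory game is a move of the original game with the
-- memory forgotten, since edges of the memory game project onto edges of the
-- original one with the same guards and resets.  Conversely every move of the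
-- original game lifts to the memory game from any memory, because the
-- successor memory prescribed by the construction always exists and stays in
-- K⊥: it is ⊥, a reset constant of the game, or the previous memory.
module Submission where

open import Defs
open import Data.Fin using (Fin)
open import Data.List.Membership.Propositional using (_∈_)
open import Data.Maybe using (Maybe; just; nothing; _<∣>_)
open import Data.Product using (∃; _,_; proj₁; proj₂)
open import Data.Rational using (ℚ; 1ℚ; _≟_)
open import Data.Rational.Properties using (1≢0)
open import Data.Sum using (inj₁; inj₂)
open import Data.Unit using (tt)
open import Relation.Binary.PropositionalEquality using (refl; sym; trans)
open import Relation.Nullary using (yes; no; contradiction)

nextMem : ℚ → Maybe ℚ → Maybe ℚ → Maybe ℚ
nextMem fl r m with fl ≟ 1ℚ
... | yes _ = nothing
... | no  _ = r <∣> m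

module _ (G : StopwatchGame) where
  open StopwatchGame G
  open ResetMemory G

  nextMem-MemUpdate : ∀ fl r m → MemUpdate fl r m (nextMem fl r m)
  nextMem-MemUpdate fl r m with fl ≟ 1ℚ
  ... | yes fl≡1 = (λ _ → refl)
                 , (λ fl≡0 → contradiction (trans (sym fl≡1) fl≡0) 1≢0)
                 , (λ fl≡0 → contradiction (trans (sym fl≡1) fl≡0) 1≢0)
  nextMem-MemUpdate fl (just c) m | no fl≢1 =
    (λ fl≡1 → contradiction fl≡1 fl≢1) , (λ _ _ eq → eq) , (λ _ ())
  nextMem-MemUpdate fl nothing  m | no fl≢1 =
    (λ fl≡1 → contradiction fl≡1 fl≢1) , (λ _ _ ()) , (λ _ _ → refl)

  nextMem-InK⊥ : ∀ {e} → e ∈ edges → (f : F) (l : Loc) (x : Fin nX) →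
                 InK⊥ (nextMem (flow l x) (Edge.rst e x) (proj₁ f x))
  nextMem-InK⊥ {e} e∈E f l x with flow l x ≟ 1ℚ
  ... | yes _ = tt
  ... | no  _ with Edge.rst e x in rst≡c
  ...   | just c  = inj₂ (inj₂ (e , e∈E , x , inj₂ (inj₂ rst≡c)))
  ...   | nothing = proj₂ f x

  nextF : ∀ {e} → e ∈ edges → F → Loc → F
  nextF {e} e∈E f l =
    (λ x → nextMem (flow l x) (Edge.rst e x) (proj₁ f x)) , nextMem-InK⊥ e∈E f l

  -- base (attach l f) reduces to l only once l is a constructor, hence the
  -- case splits on locations here and in lift-step.
  attach-IsEdgeBar : ∀ {s a φ r t} (e∈E : edge s a φ r t ∈ edges) (f : F) →
                     IsEdgeBar (edge (attach s f) a φ r (attach t (nextF e∈E f t)))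
  attach-IsEdgeBar {inj₁ _} {t = inj₁ _} e∈E f = e∈E , λ _ → nextMem-MemUpdate _ _ _
  attach-IsEdgeBar {inj₁ _} {t = inj₂ _} e∈E f = e∈E , λ _ → nextMem-MemUpdate _ _ _
  attach-IsEdgeBar {inj₂ _} {t = inj₁ _} e∈E f = e∈E , λ _ → nextMem-MemUpdate _ _ _
  attach-IsEdgeBar {inj₂ _} {t = inj₂ _} e∈E f = e∈E , λ _ → nextMem-MemUpdate _ _ _

  module _ (ℝ : RealDomain) where
    open Semantics ℝ

    project-step : ∀ {l̄ v m l̄′ v′} → Step Gbar (l̄ , v) m (l̄′ , v′) →
                   Step (toGame G) (base l̄ , v) m (base l̄′ , v′)
    project-step (edge s a φ r t , (e∈E , _) , refl , refl , refl , guards , updates) =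
      edge (base s) a φ r (base t) , e∈E , refl , refl , refl , guards , updates

    lift-step : ∀ {l v m l′ v′} (f : F) → Step (toGame G) (l , v) m (l′ , v′) →
                ∃ λ f′ → Step Gbar (attach l f , v) m (attach l′ f′ , v′)
    lift-step f (edge s@(inj₁ _) a φ r t , e∈E , refl , refl , refl , guards , updates) =
      nextF e∈E f t , edge (attach s f) a φ r (attach t (nextF e∈E f t))
                    , attach-IsEdgeBar e∈E f , refl , refl , refl , guards , updates
    lift-step f (edge s@(inj₂ _) a φ r t , e∈E , refl , refl , refl , guards , updates) =
      nextF e∈E f t , edge (attach s f) a φ r (attach t (nextF e∈E f t))
                    , attach-IsEdgeBar e∈E f , refl , refl , refl , guards , updates

    β₁-base : ∀ l̄ v → β₁ ℝ (base l̄ , v) (l̄ , v)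
    β₁-base (inj₁ (l , f)) v = mk (inj₁ l) v f
    β₁-base (inj₂ (l , f)) v = mk (inj₂ l) v f

    β₁⁻¹-isSimulation : IsSimulation Gbar (toGame G) refl (β₁⁻¹ ℝ)
    β₁⁻¹-isSimulation _ _ (mk (inj₁ _) _ _) =
      refl , refl
      , (λ _ m (l̄′ , v′) step →
           m , (base l̄′ , v′) , project-step {m = m} step , β₁-base l̄′ v′)
      , λ ()
    β₁⁻¹-isSimulation _ _ (mk (inj₂ _) _ f) =
      refl , refl , (λ ())
      , λ _ m (l′ , v′) step → let f′ , step̄ = lift-step {m = m} f step in
                               m , (attach l′ f′ , v′) , step̄ , mk l′ v′ f′

lemma6 : (ℝ : RealDomain) (G : StopwatchGame) →
    Semantics.Witnesses ℝ (ResetMemory.Gbar G) (toGame G) refl (ResetMemory.β₁⁻¹ G ℝ)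
lemma6 ℝ G =
  β₁⁻¹-isSimulation G ℝ , ResetMemory.mk (inj₁ (StopwatchGame.l₀ G)) _ (ResetMemory.f₀ G)
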